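{- Let $L$ and $L'$ be vertex-disjoint graphs such that $L\rightsquigarrow L'$ and every vertex of $L$ has even degree in $L$. Then there exists an $(L,L')$-transformer $T$ such that the degeneracy of $T$ rooted at $V(L\cup L')$ is at most $4$.
   Context: All graphs are finite and simple. A $K_3$-decomposition of a graph is a partition of its edge set into triangles. For graphs $H,H'$, a map $\phi\colon V(H)\to V(H')$ is an edge-bijective homomorphism if $\phi(x)\phi(y)\in E(H')$ for all $xy\in E(H)$ and $e(H)=e(H')=|\{\phi(x)\phi(y): xy\in E(H)\}|$; we write $H\rightsquigarrow H'$ if such a map exists. Given vertex-disjoint graphs $L,L'$, an $(L,L')$-transformer is a graph $T$ with $V(L\cup L')\subseteq V(T)$ such that $V(L\cup L')$ is independent in $T$ and both $T\cup L$ and $T\cup L'$ have a $K_3$-decomposition. For a graph $H$ and $U\subseteq V(H)$, the degeneracy of $H$ rooted at $U$ is the smallest integer $d\ge 0$ such that there is an ordering $v_1,\dots,v_{|H|-|U|}$ of $V(H)\setminus U$ with $|N_H(v_i)\cap (U\cup\{v_j: j<i\})|\le d$ for all $i$. -}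

module Defs where

open import Data.Nat using (ℕ; _<_; _≤_; _⊓_; _⊔_)
open import Data.Nat.Properties using (_≟_)
open import Data.Nat.Divisibility using (_∣_)
open import Data.Product using (_×_; _,_; proj₁; proj₂; Σ; ∃)
open import Data.Product.Properties using (≡-dec)
open import Data.Sum using (_⊎_)
open import Data.Unit using (⊤)
open import Data.List using (List; []; _∷_; _++_; length; filter; map; concatMap; deduplicate)
open import Data.List.Membership.Propositional using (_∈_; _∉_)
open import Data.List.Membership.DecPropositional _≟_ using (_∈?_)
open import Data.List.Relation.Unary.All using (All)
open import Data.List.Relation.Unary.Unique.Propositional using (Unique)
open import Data.List.Relation.Binary.Permutation.Propositional using (_↭_)
open import Relation.Nullary using (¬_; Dec)
open import Relation.Nullary.Decidable using (_⊎-dec_)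
open import Relation.Binary.PropositionalEquality using (_≡_)

-- A finite simple graph with vertices labelled by natural numbers.
-- Each edge {u,v} is stored exactly once, as the pair (u , v) with u < v.
record Graph : Set where
  field
    V       : List ℕ
    E       : List (ℕ × ℕ)
    V-uniq  : Unique V
    E-uniq  : Unique E
    E-ord   : All (λ e → proj₁ e < proj₂ e) E
    E-in-V  : All (λ e → (proj₁ e ∈ V) × (proj₂ e ∈ V)) E
open Graph public

e : Graph → ℕ
e G = length (E G)

Adj : Graph → ℕ → ℕ → Set
Adj G x y = ((x , y) ∈ E G) ⊎ ((y , x) ∈ E G)

Adj? : (G : Graph) → (x y : ℕ) → Dec (Adj G x y)
Adj? G x y = ∈-dec (x , y) (E G) ⊎-dec ∈-dec (y , x) (E G)
  where
  open import Data.List.Membership.DecPropositional (≡-dec _≟_ _≟_) renaming (_∈?_ to ∈-dec)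

N : Graph → ℕ → List ℕ
N G v = filter (Adj? G v) (V G)

deg : Graph → ℕ → ℕ
deg G v = length (N G v)

upair : ℕ → ℕ → ℕ × ℕ
upair x y = (x ⊓ y , x ⊔ y)

-- H ⇝ H' : there is an edge-bijective homomorphism φ : V(H) → V(H')
-- (φ is given as a function on ℕ; only its values on V(H) matter).
EdgeBijHom : Graph → Graph → (ℕ → ℕ) → Set
EdgeBijHom H H' φ =
  All (λ v → φ v ∈ V H') (V H)
  × All (λ xy → Adj H' (φ (proj₁ xy)) (φ (proj₂ xy))) (E H)
  × (e H ≡ e H')
  × (e H' ≡ length (deduplicate (≡-dec _≟_ _≟_)
                     (map (λ xy → upair (φ (proj₁ xy)) (φ (proj₂ xy))) (E H))))

_⇝_ : Graph → Graph → Set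
H ⇝ H' = Σ (ℕ → ℕ) (EdgeBijHom H H')

-- edge list of the graph union G ∪ H (used only when E G, E H are disjoint)
E∪ : Graph → Graph → List (ℕ × ℕ)
E∪ G H = E G ++ E H

triEdges : ℕ × ℕ × ℕ → List (ℕ × ℕ)
triEdges (a , b , c) = (a , b) ∷ (a , c) ∷ (b , c) ∷ []

-- K₃-decomposition of a graph with (duplicate-free, canonical) edge list Es:
-- a list of triangles whose edges, taken together, are exactly Es, each once.
K3Decomp : List (ℕ × ℕ) → Set
K3Decomp Es = ∃ λ (ts : List (ℕ × ℕ × ℕ)) →
  All (λ t → (proj₁ t < proj₁ (proj₂ t)) × (proj₁ (proj₂ t) < proj₂ (proj₂ t))) ts
  × (concatMap triEdges ts ↭ Es)

VertexDisjoint : Graph → Graph → Set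
VertexDisjoint L L' = ∀ v → v ∈ V L → v ∉ V L'

Independent : Graph → List ℕ → Set
Independent G U = ∀ x y → x ∈ U → y ∈ U → ¬ Adj G x y

IsTransformer : Graph → Graph → Graph → Set
IsTransformer L L' T =
  All (λ v → v ∈ V T) (V L ++ V L')
  × Independent T (V L ++ V L')
  × K3Decomp (E∪ T L)
  × K3Decomp (E∪ T L')

OrderOK : Graph → ℕ → List ℕ → List ℕ → Set
OrderOK G d placed [] = ⊤
OrderOK G d placed (v ∷ vs) =
  (length (filter (λ w → w ∈? placed) (N G v)) ≤ d) × OrderOK G d (v ∷ placed) vs

RootedDegeneracy≤ : Graph → List ℕ → ℕ → Set
RootedDegeneracy≤ G U d = ∃ λ (ord : List ℕ) →
  Unique ord
  × (∀ v → v ∈ ord → (v ∈ V G) × (v ∉ U))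
  × (∀ v → v ∈ V G → v ∉ U → v ∈ ord)
  × OrderOK G d U ord

-- For every edge e = xy of L add a vertex z_e joined to x, y, φx, φy: the triangles x y z_e and
-- φx φy z_e absorb the edges of L and, φ being edge-bijective, of L'. What is left are the spokes
-- x z_e and φx z_e, one pair for each incidence (x , e) of L. As every degree of L is even, the
-- incidences at each vertex x can be paired into wedges (x , e₁ , e₂); for each wedge add g₀ joined to
-- z_e₁, φx, x and g₁ joined to g₀, z_e₂, φx, x. Together with L the triangles φx z_e₁ g₀, φx z_e₂ g₁,
-- x g₀ g₁ use up the φ-spokes and the wedge edges, together with L' the triangles x z_e₁ g₀,
-- x z_e₂ g₁, φx g₀ g₁ use up the plain spokes. Adding first the z_e and then the g's, every new
-- vertex has at most four earlier neighbours.

module Submission where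

open import Defs
open import Data.Nat using (ℕ; suc; _+_; _*_; _≤_; _<_; z≤n; s≤s; s≤s⁻¹; NonZero)
open import Data.Nat.Properties
  using (_≟_; <-cmp; <⇒≤; ≤-refl; ≤-trans; ≤-reflexive; <-≤-trans; <⇒≢; <-irrefl; m<n⇒m<1+n; n<1+n; m≤m+n; m≤n+m;
         +-cancelˡ-≡; *-cancelʳ-≡; +-monoˡ-<; +-monoʳ-<; *-monoˡ-≤; ≤-total;
         m≤n⇒m⊓n≡m; m≤n⇒m⊔n≡n; m≥n⇒m⊓n≡n; m≥n⇒m⊔n≡m; ⊓-comm; ⊔-comm; module ≤-Reasoning)
open import Data.Nat.DivMod using (_%_; m<n⇒m%n≡m; [m+kn]%n≡m%n)
open import Data.Nat.Divisibility using (_∣_; ∣1⇒≡1; ∣m+n∣m⇒∣n; ∣-refl)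
open import Data.Product using (_×_; _,_; proj₁; proj₂; ∃)
open import Data.Product.Properties using (≡-dec)
open import Data.Sum using (_⊎_; inj₁; inj₂; [_,_]′)
open import Data.Empty using (⊥-elim)
open import Data.Unit using (⊤; tt)
open import Function using (_∘_; id)
open import Relation.Nullary using (contradiction)
open import Relation.Binary.Definitions using (tri<; tri≈; tri>)
open import Relation.Binary.PropositionalEquality
  using (_≡_; _≢_; refl; sym; trans; cong; cong₂; subst; module ≡-Reasoning)

open import Data.List using (List; []; _∷_; _++_; [_]; length; filter; map; concat; concatMap; deduplicate)
open import Data.List.Properties
  using (concatMap-++; concatMap-map; map-concatMap; concatMap-pure; map-cong-local; map-∘; map-id; length-map)
open import Data.List.Extrema.Nat using (max; xs≤max)
open import Data.List.Membership.Propositional using (_∈_; _∉_; find; lose)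
open import Data.List.Membership.Propositional.Properties
  using (∈-∃++; ∈-++⁺ˡ; ∈-++⁺ʳ; ∈-++⁻; ∈-map⁺; ∈-map⁻; ∈-filter⁺; ∈-filter⁻;
         ∈-concatMap⁺; ∈-concatMap⁻; ∈-deduplicate⁻)
open import Data.List.Membership.DecPropositional _≟_ using (_∈?_)
open import Data.List.Relation.Binary.Disjoint.Propositional using (Disjoint)
open import Data.List.Relation.Binary.Subset.Propositional using (_⊆_)
open import Data.List.Relation.Binary.Permutation.Propositional
  using (_↭_; ↭-refl; ↭-sym; ↭-trans; prep; swap; module PermutationReasoning)
open import Data.List.Relation.Binary.Permutation.Propositional.Properties
  using (shift; ↭-length; ++⁺; ++⁺ˡ; ++⁺ʳ; ∈-resp-↭; ++-commutativeMonoid)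
  renaming (map⁺ to ↭-map⁺)
open import Data.List.Relation.Unary.All as All using (All; []; _∷_)
import Data.List.Relation.Unary.All.Properties as All
open import Data.List.Relation.Unary.AllPairs using ([]; _∷_)
open import Data.List.Relation.Unary.Any using (here; there)
open import Data.List.Relation.Unary.Unique.Propositional using (Unique)
import Data.List.Relation.Unary.Unique.Propositional.Properties as Unique
open import Data.List.Relation.Unary.Unique.DecPropositional.Properties (≡-dec _≟_ _≟_)
  using (deduplicate-!)
import Algebra.Solver.CommutativeMonoid as CommutativeMonoidSolver

module ++-Solver (A : Set) = CommutativeMonoidSolver (++-commutativeMonoid {A = A})

-- Lists

module _ {A : Set} where

  Unique-∷ : ∀ {x : A} {xs} → x ∉ xs → Unique xs → Unique (x ∷ xs)
  Unique-∷ x∉xs xs! = All.tabulate (λ { y∈xs refl → x∉xs y∈xs }) ∷ xs!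

  Unique-pair : ∀ {x y : A} → x ≢ y → Unique (x ∷ y ∷ [])
  Unique-pair x≢y = (x≢y ∷ []) ∷ [] ∷ []

  Unique∷-⊆⇒↭∷ : ∀ {x : A} {xs ys} → Unique (x ∷ xs) → x ∷ xs ⊆ ys →
                 ∃ λ zs → ys ↭ x ∷ zs × xs ⊆ zs
  Unique∷-⊆⇒↭∷ {x} {xs} (x∉xs ∷ _) ⊆ys with ∈-∃++ (⊆ys (here refl))
  ... | as , bs , refl = as ++ bs , shift x as bs , xs⊆as++bs
    where
    xs⊆as++bs : xs ⊆ as ++ bs
    xs⊆as++bs {y} y∈xs with ∈-++⁻ as (⊆ys (there y∈xs))
    ... | inj₁ y∈as         = ∈-++⁺ˡ y∈as
    ... | inj₂ (here refl)  = ⊥-elim (All.lookup x∉xs y∈xs refl)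
    ... | inj₂ (there y∈bs) = ∈-++⁺ʳ as y∈bs

  Unique-⊆⇒length≤ : ∀ {xs ys : List A} → Unique xs → xs ⊆ ys → length xs ≤ length ys
  Unique-⊆⇒length≤ {[]}     _                 _   = z≤n
  Unique-⊆⇒length≤ {x ∷ xs} x∷xs!@(_ ∷ xs!) ⊆ys =
    let zs , ys↭ , xs⊆zs = Unique∷-⊆⇒↭∷ x∷xs! ⊆ys
    in  ≤-trans (s≤s (Unique-⊆⇒length≤ xs! xs⊆zs)) (≤-reflexive (sym (↭-length ys↭)))

  Unique-⊆-length≤⇒↭ : ∀ {xs ys : List A} → Unique xs → xs ⊆ ys → length ys ≤ length xs → xs ↭ ys
  Unique-⊆-length≤⇒↭ {[]}     {[]}    _ _ _ = ↭-refl
  Unique-⊆-length≤⇒↭ {[]}     {_ ∷ _} _ _ ()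
  Unique-⊆-length≤⇒↭ {x ∷ xs} x∷xs!@(_ ∷ xs!) ⊆ys ys≤ =
    let zs , ys↭ , xs⊆zs = Unique∷-⊆⇒↭∷ x∷xs! ⊆ys
        zs≤ = s≤s⁻¹ (subst (_≤ suc (length xs)) (↭-length ys↭) ys≤)
    in  ↭-trans (prep x (Unique-⊆-length≤⇒↭ xs! xs⊆zs zs≤)) (↭-sym ys↭)

  Unique-⊆-⊇⇒↭ : ∀ {xs ys : List A} → Unique xs → Unique ys → xs ⊆ ys → ys ⊆ xs → xs ↭ ys
  Unique-⊆-⊇⇒↭ xs! ys! xs⊆ys ys⊆xs = Unique-⊆-length≤⇒↭ xs! xs⊆ys (Unique-⊆⇒length≤ ys! ys⊆xs)

  ∈-functional : ∀ {B : Set} {xs : List (A × B)} {k a b} →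
                 Unique (map proj₁ xs) → (k , a) ∈ xs → (k , b) ∈ xs → a ≡ b
  ∈-functional _            (here refl) (here refl) = refl
  ∈-functional (k∉ ∷ _)     (here refl) (there kb∈) = ⊥-elim (All.lookup k∉ (∈-map⁺ proj₁ kb∈) refl)
  ∈-functional (k∉ ∷ _)     (there ka∈) (here refl) = ⊥-elim (All.lookup k∉ (∈-map⁺ proj₁ ka∈) refl)
  ∈-functional (_ ∷ keys!)  (there ka∈) (there kb∈) = ∈-functional keys! ka∈ kb∈

  module _ {B : Set} where

    Unique-map⁺-on : ∀ {f : A → B} {xs} → (∀ {x y} → x ∈ xs → y ∈ xs → f x ≡ f y → x ≡ y) →
                     Unique xs → Unique (map f xs)
    Unique-map⁺-on {xs = []}     _   _            = []
    Unique-map⁺-on {xs = x ∷ xs} inj (x∉xs ∷ xs!) =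
      All.map⁺ (All.tabulate λ y∈xs fx≡fy → All.lookup x∉xs y∈xs (inj (here refl) (there y∈xs) fx≡fy)) ∷
      Unique-map⁺-on (λ x∈ y∈ → inj (there x∈) (there y∈)) xs!

    All-concatMap⁺ : ∀ {P : B → Set} {f : A → List B} {xs} →
                     (∀ {x} → x ∈ xs → All P (f x)) → All P (concatMap f xs)
    All-concatMap⁺ Pf = All.concat⁺ (All.map⁺ (All.tabulate Pf))

    concatMap⁺-↭ : ∀ {f g : A → List B} xs → (∀ x → f x ↭ g x) → concatMap f xs ↭ concatMap g xs
    concatMap⁺-↭ []       _   = ↭-refl
    concatMap⁺-↭ (x ∷ xs) f↭g = ++⁺ (f↭g x) (concatMap⁺-↭ xs f↭g)

    concatMap-++-↭ : ∀ (f g : A → List B) xs →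
                     concatMap (λ x → f x ++ g x) xs ↭ concatMap f xs ++ concatMap g xs
    concatMap-++-↭ f g []       = ↭-refl
    concatMap-++-↭ f g (x ∷ xs) =
      ↭-trans (++⁺ˡ (f x ++ g x) (concatMap-++-↭ f g xs))
              (solve 4 (λ a b c d → (a ⊕ b) ⊕ (c ⊕ d) ⊜ (a ⊕ c) ⊕ (b ⊕ d)) ↭-refl
                     (f x) (g x) (concatMap f xs) (concatMap g xs))
      where open ++-Solver B using (solve; _⊜_; _⊕_)

    module _ {C : Set} where

      concatMap-concatMap : ∀ (f : B → List C) (g : A → List B) xs →
                            concatMap f (concatMap g xs) ≡ concatMap (concatMap f ∘ g) xs
      concatMap-concatMap f g []       = refl
      concatMap-concatMap f g (x ∷ xs) =
        trans (concatMap-++ f (g x) (concatMap g xs)) (cong (concatMap f (g x) ++_) (concatMap-concatMap f g xs))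

      Unique-concatMap : ∀ {f : A → List B} (tag : B → C) (key : A → C) →
                         (∀ {x b} → b ∈ f x → tag b ≡ key x) →
                         ∀ {xs} → Unique (map key xs) → All (Unique ∘ f) xs → Unique (concatMap f xs)
      Unique-concatMap         tag key tagged {[]}     _             _            = []
      Unique-concatMap {f = f} tag key tagged {x ∷ xs} (kx∉ ∷ keys!) (fx! ∷ fxs!) =
        Unique.++⁺ fx! (Unique-concatMap tag key tagged keys! fxs!) disjoint
        where
        disjoint : Disjoint (f x) (concatMap f xs)
        disjoint (b∈fx , b∈fxs) =
          let y , y∈xs , b∈fy = find (∈-concatMap⁻ f {xs = xs} b∈fxs)
          in  All.lookup kx∉ (∈-map⁺ key y∈xs) (trans (sym (tagged b∈fx)) (tagged b∈fy))

  pairs : List A → List (A × A)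
  pairs (a ∷ b ∷ xs) = (a , b) ∷ pairs xs
  pairs _            = []

  unpair : A × A → List A
  unpair (a , b) = a ∷ b ∷ []

  concatMap-unpair-pairs : ∀ xs → 2 ∣ length xs → concatMap unpair (pairs xs) ≡ xs
  concatMap-unpair-pairs []           _   = refl
  concatMap-unpair-pairs (_ ∷ [])     2∣1 = contradiction (∣1⇒≡1 2∣1) λ ()
  concatMap-unpair-pairs (a ∷ b ∷ xs) 2∣  =
    cong (λ ys → a ∷ b ∷ ys) (concatMap-unpair-pairs xs (∣m+n∣m⇒∣n 2∣ ∣-refl))

  indexedFrom : ℕ → List A → List (ℕ × A)
  indexedFrom n []       = []
  indexedFrom n (x ∷ xs) = (n , x) ∷ indexedFrom (suc n) xs

  map-proj₂-indexedFrom : ∀ n xs → map proj₂ (indexedFrom n xs) ≡ xs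
  map-proj₂-indexedFrom n []       = refl
  map-proj₂-indexedFrom n (x ∷ xs) = cong (x ∷_) (map-proj₂-indexedFrom (suc n) xs)

  ∈-indexedFrom⁻ : ∀ {n i x} xs → (i , x) ∈ indexedFrom n xs → x ∈ xs
  ∈-indexedFrom⁻ {n} xs ix∈ = subst (_ ∈_) (map-proj₂-indexedFrom n xs) (∈-map⁺ proj₂ ix∈)

All-<⇒∉ : ∀ {v xs} → All (_< v) xs → v ∉ xs
All-<⇒∉ xs<v v∈xs = <-irrefl refl (All.lookup xs<v v∈xs)

Unique-∷-above : ∀ {v xs} → All (_< v) xs → Unique xs → Unique (v ∷ xs)
Unique-∷-above xs<v = Unique-∷ (All-<⇒∉ xs<v)

-- Numerals and unordered pairs

two-digit-injective : ∀ {K a a' b b'} .{{_ : NonZero K}} → b < K → b' < K →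
                      b + a * K ≡ b' + a' * K → a ≡ a' × b ≡ b'
two-digit-injective {K} {a} {a'} {b} {b'} b<K b'<K eq = a≡a' , b≡b'
  where
  open ≡-Reasoning
  b≡b' : b ≡ b'
  b≡b' = begin
    b                  ≡⟨ m<n⇒m%n≡m b<K ⟨
    b % K              ≡⟨ [m+kn]%n≡m%n b a K ⟨
    (b + a * K) % K    ≡⟨ cong (_% K) eq ⟩
    (b' + a' * K) % K  ≡⟨ [m+kn]%n≡m%n b' a' K ⟩
    b' % K             ≡⟨ m<n⇒m%n≡m b'<K ⟩
    b'                 ∎
  a≡a' : a ≡ a'
  a≡a' = *-cancelʳ-≡ a a' K (+-cancelˡ-≡ b _ _ (trans eq (cong (_+ a' * K) (sym b≡b'))))

two-digit-< : ∀ {K a b} → a < K → b < K → b + a * K < K * K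
two-digit-< {K} {a} {b} a<K b<K = begin-strict
  b + a * K  <⟨ +-monoˡ-< (a * K) b<K ⟩
  suc a * K  ≤⟨ *-monoˡ-≤ K a<K ⟩
  K * K      ∎
  where open ≤-Reasoning

upair-≡ : ∀ a b → upair a b ≡ (a , b) ⊎ upair a b ≡ (b , a)
upair-≡ a b with ≤-total a b
... | inj₁ a≤b = inj₁ (cong₂ _,_ (m≤n⇒m⊓n≡m a≤b) (m≤n⇒m⊔n≡n a≤b))
... | inj₂ b≤a = inj₂ (cong₂ _,_ (m≥n⇒m⊓n≡n b≤a) (m≥n⇒m⊔n≡m b≤a))

upair-comm : ∀ a b → upair a b ≡ upair b a
upair-comm a b = cong₂ _,_ (⊓-comm a b) (⊔-comm a b)

upair-< : ∀ {a b} → a < b → upair a b ≡ (a , b)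
upair-< a<b = cong₂ _,_ (m≤n⇒m⊓n≡m (<⇒≤ a<b)) (m≤n⇒m⊔n≡n (<⇒≤ a<b))

upair-> : ∀ {a b} → b < a → upair a b ≡ (b , a)
upair-> {a} {b} b<a = trans (upair-comm a b) (upair-< b<a)

upair-injectiveʳ : ∀ x {y y'} → upair x y ≡ upair x y' → y ≡ y'
upair-injectiveʳ x {y} {y'} eq with upair-≡ x y | upair-≡ x y'
... | inj₁ p | inj₁ q = cong proj₂ (trans (sym p) (trans eq q))
... | inj₁ p | inj₂ q = let r = trans (sym p) (trans eq q) in trans (cong proj₂ r) (cong proj₁ r)
... | inj₂ p | inj₁ q = let r = trans (sym p) (trans eq q) in trans (cong proj₁ r) (cong proj₂ r)
... | inj₂ p | inj₂ q = cong proj₁ (trans (sym p) (trans eq q))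

upair-increasing : ∀ {a b} → a ≢ b → proj₁ (upair a b) < proj₂ (upair a b)
upair-increasing {a} {b} a≢b with <-cmp a b
... | tri< a<b _ _ = subst (λ (p : ℕ × ℕ) → proj₁ p < proj₂ p) (sym (upair-< a<b)) a<b
... | tri≈ _ a≡b _ = contradiction a≡b a≢b
... | tri> _ _ b<a = subst (λ (p : ℕ × ℕ) → proj₁ p < proj₂ p) (sym (upair-> b<a)) b<a

upair-elim : ∀ (P : ℕ × ℕ → Set) a b → P (a , b) → P (b , a) → P (upair a b)
upair-elim P a b Pab Pba = [ (λ eq → subst P (sym eq) Pab) , (λ eq → subst P (sym eq) Pba) ]′ (upair-≡ a b)

upair-below : ∀ {a b c} → a < c → b < c → proj₂ (upair a b) < c
upair-below {a} {b} {c} a<c b<c = upair-elim (λ q → proj₂ q < c) a b b<c a<c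

upair-spokes-↭ : ∀ a b c → _↭_ {A = ℕ × ℕ} ((proj₁ (upair a b) , c) ∷ (proj₂ (upair a b) , c) ∷ [])
                                            ((a , c) ∷ (b , c) ∷ [])
upair-spokes-↭ a b c = upair-elim (λ q → (proj₁ q , c) ∷ (proj₂ q , c) ∷ [] ↭ (a , c) ∷ (b , c) ∷ []) a b
                                  ↭-refl (swap _ _ ↭-refl)

ends : ℕ × ℕ → List (ℕ × (ℕ × ℕ))
ends (x , y) = (x , (x , y)) ∷ (y , (x , y)) ∷ []

∈-ends-upair : ∀ x y → (x , upair x y) ∈ ends (upair x y)
∈-ends-upair x y = upair-elim (λ q → (x , q) ∈ ends q) x y (here refl) (there (here refl))

Adj⇒≢ : ∀ (G : Graph) {a b} → Adj G a b → a ≢ b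
Adj⇒≢ G (inj₁ ab∈) refl = <-irrefl refl (All.lookup (E-ord G) ab∈)
Adj⇒≢ G (inj₂ ba∈) refl = <-irrefl refl (All.lookup (E-ord G) ba∈)

Adj⇒upair∈E : ∀ (G : Graph) {a b} → Adj G a b → upair a b ∈ E G
Adj⇒upair∈E G (inj₁ ab∈) = subst (_∈ E G) (sym (upair-< (All.lookup (E-ord G) ab∈))) ab∈
Adj⇒upair∈E G (inj₂ ba∈) = subst (_∈ E G) (sym (upair-> (All.lookup (E-ord G) ba∈))) ba∈

-- Graphs grown one vertex at a time

Step : Set
Step = ℕ × List ℕ

stepEdges : Step → List (ℕ × ℕ)
stepEdges (v , bs) = map (_, v) bs

newVertices : List Step → List ℕ
newVertices = map proj₁

record Attaches (d : ℕ) (P : List ℕ) (s : Step) : Set where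
  constructor attaches
  field
    back-placed : All (_∈ P) (proj₂ s)
    back-unique : Unique (proj₂ s)
    back-count  : length (proj₂ s) ≤ d
    back-below  : All (_< proj₁ s) (proj₂ s)
open Attaches

Attaches-mono : ∀ {d P Q s} → P ⊆ Q → Attaches d P s → Attaches d Q s
Attaches-mono P⊆Q (attaches placed unique count below) = attaches (All.map P⊆Q placed) unique count below

ValidSteps : ℕ → List ℕ → List Step → Set
ValidSteps d P []       = ⊤
ValidSteps d P (s ∷ ss) = proj₁ s ∉ P × Attaches d P s × ValidSteps d (proj₁ s ∷ P) ss

ValidSteps-fresh : ∀ {d P} ss → ValidSteps d P ss → All (_∉ P) (newVertices ss)
ValidSteps-fresh []       _                  = []
ValidSteps-fresh (s ∷ ss) (s∉P , _ , valid) = s∉P ∷ All.map (_∘ there) (ValidSteps-fresh ss valid)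

ValidSteps-unique : ∀ {d P} ss → ValidSteps d P ss → Unique (newVertices ss)
ValidSteps-unique []       _              = []
ValidSteps-unique (s ∷ ss) (_ , _ , valid) =
  Unique-∷ (λ s∈ss → All.lookup (ValidSteps-fresh ss valid) s∈ss (here refl)) (ValidSteps-unique ss valid)

ValidSteps⇒Attaches : ∀ {d P} ss → ValidSteps d P ss → ∀ {s} → s ∈ ss → Attaches d (P ++ newVertices ss) s
ValidSteps⇒Attaches         (s ∷ ss) (_ , att , _)    (here refl) = Attaches-mono ∈-++⁺ˡ att
ValidSteps⇒Attaches {P = P} (s ∷ ss) (_ , _ , valid) (there t∈) = Attaches-mono moved (ValidSteps⇒Attaches ss valid t∈)
  where
  moved : (proj₁ s ∷ P) ++ newVertices ss ⊆ P ++ newVertices (s ∷ ss)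
  moved (here refl) = ∈-++⁺ʳ P (here refl)
  moved (there u∈) with ∈-++⁻ P u∈
  ... | inj₁ u∈P  = ∈-++⁺ˡ u∈P
  ... | inj₂ u∈ss = ∈-++⁺ʳ P (there u∈ss)

ValidSteps-parallel : ∀ {d P} ss → Unique (newVertices ss) → All (_∉ P) (newVertices ss) →
                      All (Attaches d P) ss → ValidSteps d P ss
ValidSteps-parallel         []       _             _              _            = tt
ValidSteps-parallel {P = P} (s ∷ ss) (s∉ss ∷ ss!) (s∉P ∷ ss∉P) (att ∷ atts) =
  s∉P , att , ValidSteps-parallel ss ss! (All.zipWith fresh (s∉ss , ss∉P)) (All.map (Attaches-mono there) atts)
  where
  fresh : ∀ {v} → proj₁ s ≢ v × v ∉ P → v ∉ proj₁ s ∷ P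
  fresh (s≢v , v∉P) (here v≡s)  = s≢v (sym v≡s)
  fresh (s≢v , v∉P) (there v∈P) = v∉P v∈P

placed : List ℕ → List Step → List ℕ
placed P []       = P
placed P (s ∷ ss) = placed (proj₁ s ∷ P) ss

ValidSteps-++ : ∀ {d} P ss ts → ValidSteps d P ss → ValidSteps d (placed P ss) ts → ValidSteps d P (ss ++ ts)
ValidSteps-++ P []       ts _                   valid = valid
ValidSteps-++ P (s ∷ ss) ts (s∉P , att , valid) valid' = s∉P , att , ValidSteps-++ (proj₁ s ∷ P) ss ts valid valid'

∈-placed⁺ˡ : ∀ {w} P ss → w ∈ P → w ∈ placed P ss
∈-placed⁺ˡ P []       w∈P = w∈P
∈-placed⁺ˡ P (s ∷ ss) w∈P = ∈-placed⁺ˡ (proj₁ s ∷ P) ss (there w∈P)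

∈-placed⁺ʳ : ∀ {w} P ss → w ∈ newVertices ss → w ∈ placed P ss
∈-placed⁺ʳ P (s ∷ ss) (here refl) = ∈-placed⁺ˡ (proj₁ s ∷ P) ss (here refl)
∈-placed⁺ʳ P (s ∷ ss) (there w∈)  = ∈-placed⁺ʳ (proj₁ s ∷ P) ss w∈

∈-placed⁻ : ∀ {w} P ss → w ∈ placed P ss → w ∈ P ⊎ w ∈ newVertices ss
∈-placed⁻ P []       w∈ = inj₁ w∈
∈-placed⁻ P (s ∷ ss) w∈ with ∈-placed⁻ (proj₁ s ∷ P) ss w∈
... | inj₁ (here w≡s)  = inj₂ (here w≡s)
... | inj₁ (there w∈P) = inj₁ w∈P
... | inj₂ w∈ss        = inj₂ (there w∈ss)

module StepGraph {d : ℕ} (U : List ℕ) (U! : Unique U) (ss : List Step) (valid : ValidSteps d U ss) where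

  private
    new∉U : All (_∉ U) (newVertices ss)
    new∉U = ValidSteps-fresh ss valid

    new! : Unique (newVertices ss)
    new! = ValidSteps-unique ss valid

    attached : ∀ {s} → s ∈ ss → Attaches d (U ++ newVertices ss) s
    attached = ValidSteps⇒Attaches ss valid

    vertices! : Unique (U ++ newVertices ss)
    vertices! = Unique.++⁺ U! new! λ (u∈U , u∈new) → All.lookup new∉U u∈new u∈U

    ∈-edges⁻ : ∀ {u v} → (u , v) ∈ concatMap stepEdges ss → ∃ λ bs → (v , bs) ∈ ss × u ∈ bs
    ∈-edges⁻ uv∈ with find (∈-concatMap⁻ stepEdges {xs = ss} uv∈)
    ... | (w , bs) , s∈ss , uv∈s with ∈-map⁻ (_, w) uv∈s
    ...   | u , u∈bs , refl = bs , s∈ss , u∈bs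

    edges! : Unique (concatMap stepEdges ss)
    edges! = Unique-concatMap proj₂ proj₁ tagged new!
               (All.tabulate λ s∈ → Unique.map⁺ (cong proj₁) (back-unique (attached s∈)))
      where
      tagged : ∀ {s e} → e ∈ stepEdges s → proj₂ e ≡ proj₁ s
      tagged {s} e∈ with ∈-map⁻ (_, proj₁ s) e∈
      ... | _ , _ , refl = refl

  graph : Graph
  graph = record
    { V      = U ++ newVertices ss
    ; E      = concatMap stepEdges ss
    ; V-uniq = vertices!
    ; E-uniq = edges!
    ; E-ord  = All.tabulate λ uv∈ → let _ , s∈ , u∈bs = ∈-edges⁻ uv∈ in
                 All.lookup (back-below (attached s∈)) u∈bs
    ; E-in-V = All.tabulate λ uv∈ → let _ , s∈ , u∈bs = ∈-edges⁻ uv∈ in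
                 All.lookup (back-placed (attached s∈)) u∈bs , ∈-++⁺ʳ U (∈-map⁺ proj₁ s∈)
    }

  roots-in : All (_∈ V graph) U
  roots-in = All.tabulate ∈-++⁺ˡ

  roots-independent : Independent graph U
  roots-independent x y x∈U y∈U (inj₁ xy∈) =
    let _ , s∈ , _ = ∈-edges⁻ xy∈ in All.lookup new∉U (∈-map⁺ proj₁ s∈) y∈U
  roots-independent x y x∈U y∈U (inj₂ yx∈) =
    let _ , s∈ , _ = ∈-edges⁻ yx∈ in All.lookup new∉U (∈-map⁺ proj₁ s∈) x∈U

  private
    Closed : List ℕ → Set
    Closed P = ∀ {v bs} → (v , bs) ∈ ss → v ∈ P → All (_∈ P) bs

    -- A neighbour of v placed before v is either a back-neighbour of v or has v as a back-neighbour;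
    -- the latter is impossible since v is not yet placed.
    placed-neighbours⊆back : ∀ {P v bs} → Closed P → (v , bs) ∈ ss → v ∉ P → filter (_∈? P) (N graph v) ⊆ bs
    placed-neighbours⊆back {P} {v} closed s∈ v∉P w∈ with ∈-filter⁻ (_∈? P) {xs = N graph v} w∈
    ... | w∈N , w∈P with proj₂ (∈-filter⁻ (Adj? graph v) {xs = V graph} w∈N)
    ...   | inj₁ vw∈ = let _ , t∈ , v∈bs' = ∈-edges⁻ vw∈ in ⊥-elim (v∉P (All.lookup (closed t∈ w∈P) v∈bs'))
    ...   | inj₂ wv∈ = let _ , t∈ , w∈bs' = ∈-edges⁻ wv∈ in subst (_ ∈_) (∈-functional new! t∈ s∈) w∈bs'

    order-ok : ∀ P ts → ValidSteps d P ts → ts ⊆ ss → Closed P → OrderOK graph d P (newVertices ts)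
    order-ok P []              _                   _     _      = tt
    order-ok P ((v , bs) ∷ ts) (v∉P , att , valid') ts⊆ss closed =
      ≤-trans (Unique-⊆⇒length≤ (Unique.filter⁺ _ (Unique.filter⁺ _ vertices!))
                                (placed-neighbours⊆back closed s∈ v∉P))
              (back-count att) ,
      order-ok (v ∷ P) ts valid' (λ t∈ → ts⊆ss (there t∈)) closed'
      where
      s∈ = ts⊆ss (here refl)
      closed' : Closed (v ∷ P)
      closed' t∈ (here refl) = All.map there (subst (All (_∈ P)) (∈-functional new! s∈ t∈) (back-placed att))
      closed' t∈ (there w∈P) = All.map there (closed t∈ w∈P)

  degeneracy : RootedDegeneracy≤ graph U d
  degeneracy =
    newVertices ss , new! ,
    (λ v v∈ → ∈-++⁺ʳ U v∈ , All.lookup new∉U v∈) ,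
    (λ v v∈V v∉U → [ (λ v∈U → contradiction v∈U v∉U) , id ]′ (∈-++⁻ U v∈V)) ,
    order-ok U ss valid id (λ s∈ v∈U → contradiction v∈U (All.lookup new∉U (∈-map⁺ proj₁ s∈)))

-- The transformer

Increasing : ℕ × ℕ × ℕ → Set
Increasing (a , b , c) = a < b × b < c

module Transformer (L L' : Graph) (L∩L'=∅ : VertexDisjoint L L') (φ : ℕ → ℕ) (hom : EdgeBijHom L L' φ)
                   (even-degrees : All (λ v → 2 ∣ deg L v) (V L)) where

  φ-V : ∀ {x} → x ∈ V L → φ x ∈ V L'
  φ-V = All.lookup (proj₁ hom)

  φ-Adj : ∀ {x y} → (x , y) ∈ E L → Adj L' (φ x) (φ y)
  φ-Adj = All.lookup (proj₁ (proj₂ hom))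

  L-V : ∀ {x y} → (x , y) ∈ E L → x ∈ V L × y ∈ V L
  L-V = All.lookup (E-in-V L)

  L-< : ∀ {x y} → (x , y) ∈ E L → x < y
  L-< = All.lookup (E-ord L)

  φ≢ : ∀ {x} → x ∈ V L → φ x ≢ x
  φ≢ {x} x∈ φx≡x = L∩L'=∅ x x∈ (subst (_∈ V L') φx≡x (φ-V x∈))

  roots : List ℕ
  roots = V L ++ V L'

  roots! : Unique roots
  roots! = Unique.++⁺ (V-uniq L) (V-uniq L') λ (v∈L , v∈L') → L∩L'=∅ _ v∈L v∈L'

  inL : ∀ {x} → x ∈ V L → x ∈ roots
  inL = ∈-++⁺ˡ

  inL' : ∀ {x} → x ∈ V L' → x ∈ roots
  inL' = ∈-++⁺ʳ (V L)

  -- Vertex numbering: roots < K ≤ edgeVertex e < K₂ ≤ gadget vertices, so every new vertex is fresh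
  -- and exceeds its back-neighbours, and every triangle below is listed in increasing order.
  K : ℕ
  K = suc (max 0 roots)

  K₂ : ℕ
  K₂ = K + K * K

  root<K : ∀ {u} → u ∈ roots → u < K
  root<K u∈ = s≤s (All.lookup (xs≤max 0 roots) u∈)

  edgeVertex : ℕ × ℕ → ℕ
  edgeVertex (x , y) = K + (y + x * K)

  root<edgeVertex : ∀ {u} e → u ∈ roots → u < edgeVertex e
  root<edgeVertex e u∈ = <-≤-trans (root<K u∈) (m≤m+n K _)

  edgeVertex<K₂ : ∀ {x y} → (x , y) ∈ E L → edgeVertex (x , y) < K₂
  edgeVertex<K₂ xy∈ = +-monoʳ-< K (two-digit-< (root<K (inL (proj₁ (L-V xy∈)))) (root<K (inL (proj₂ (L-V xy∈)))))

  edgeVertex-injective : ∀ {x y x' y'} → (x , y) ∈ E L → (x' , y') ∈ E L →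
                         edgeVertex (x , y) ≡ edgeVertex (x' , y') → (x , y) ≡ (x' , y')
  edgeVertex-injective {x} {y} {x'} {y'} e∈ e'∈ eq
    with two-digit-injective {K} {x} {x'} {y} {y'} (root<K (inL (proj₂ (L-V e∈)))) (root<K (inL (proj₂ (L-V e'∈))))
                             (+-cancelˡ-≡ K _ _ eq)
  ... | refl , refl = refl

  gadget₀ gadget₁ : ℕ → ℕ
  gadget₀ i = i * 2 + K₂
  gadget₁ i = suc (gadget₀ i)

  edgeVertex<gadget₀ : ∀ {e} i → e ∈ E L → edgeVertex e < gadget₀ i
  edgeVertex<gadget₀ i e∈ = <-≤-trans (edgeVertex<K₂ e∈) (m≤n+m K₂ (i * 2))

  root<gadget₀ : ∀ {u} i → u ∈ roots → u < gadget₀ i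
  root<gadget₀ i u∈ = <-≤-trans (root<K u∈) (≤-trans (m≤m+n K (K * K)) (m≤n+m K₂ (i * 2)))

  Incidence : Set
  Incidence = ℕ × (ℕ × ℕ)

  incidences : List Incidence
  incidences = concatMap ends (E L)

  incidentEdges : ℕ → List (ℕ × ℕ)
  incidentEdges x = map (upair x) (N L x)

  incidencesAt : ℕ → List Incidence
  incidencesAt x = map (x ,_) (incidentEdges x)

  incidencesAt-↭ : concatMap incidencesAt (V L) ↭ incidences
  incidencesAt-↭ = Unique-⊆-⊇⇒↭ incidencesAt! incidences! ⊆incidences incidences⊆
    where
    incidencesAt! : Unique (concatMap incidencesAt (V L))
    incidencesAt! = Unique-concatMap proj₁ id tagged (Unique.map⁺ id (V-uniq L)) (All.tabulate λ {x} _ →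
      Unique.map⁺ (cong proj₂) (Unique.map⁺ (upair-injectiveʳ x) (Unique.filter⁺ (Adj? L x) (V-uniq L))))
      where
      tagged : ∀ {x i} → i ∈ incidencesAt x → proj₁ i ≡ x
      tagged {x} i∈ with ∈-map⁻ (x ,_) i∈
      ... | _ , _ , refl = refl

    incidences! : Unique incidences
    incidences! = Unique-concatMap proj₂ id tagged (Unique.map⁺ id (E-uniq L))
      (All.tabulate λ e∈ → Unique-pair (<⇒≢ (L-< e∈) ∘ cong proj₁))
      where
      tagged : ∀ {e i} → i ∈ ends e → proj₂ i ≡ e
      tagged (here refl)         = refl
      tagged (there (here refl)) = refl

    ⊆incidences : concatMap incidencesAt (V L) ⊆ incidences
    ⊆incidences i∈ with find (∈-concatMap⁻ incidencesAt {xs = V L} i∈)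
    ... | x , _ , i∈x with ∈-map⁻ (x ,_) i∈x
    ...   | _ , e∈ , refl with ∈-map⁻ (upair x) e∈
    ...     | y , y∈N , refl =
      ∈-concatMap⁺ ends (lose (Adj⇒upair∈E L (proj₂ (∈-filter⁻ (Adj? L x) {xs = V L} y∈N))) (∈-ends-upair x y))

    at : ∀ {x y e} → x ∈ V L → y ∈ V L → Adj L x y → upair x y ≡ e → (x , e) ∈ concatMap incidencesAt (V L)
    at {x} x∈ y∈ adj refl =
      ∈-concatMap⁺ incidencesAt (lose x∈ (∈-map⁺ (x ,_) (∈-map⁺ (upair x) (∈-filter⁺ (Adj? L x) y∈ adj))))

    incidences⊆ : incidences ⊆ concatMap incidencesAt (V L)
    incidences⊆ i∈ with find (∈-concatMap⁻ ends {xs = E L} i∈)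
    ... | _ , xy∈ , here refl         = at (proj₁ (L-V xy∈)) (proj₂ (L-V xy∈)) (inj₁ xy∈) (upair-< (L-< xy∈))
    ... | _ , xy∈ , there (here refl) = at (proj₂ (L-V xy∈)) (proj₁ (L-V xy∈)) (inj₂ xy∈) (upair-> (L-< xy∈))

  incidence-ok : ∀ {x e} → (x , e) ∈ incidences → x ∈ V L × e ∈ E L
  incidence-ok xe∈ with find (∈-concatMap⁻ ends {xs = E L} xe∈)
  ... | _ , xy∈ , here refl         = proj₁ (L-V xy∈) , xy∈
  ... | _ , xy∈ , there (here refl) = proj₂ (L-V xy∈) , xy∈

  Wedge : Set
  Wedge = ℕ × (ℕ × ℕ) × (ℕ × ℕ)

  wedgesAt : ℕ → List Wedge
  wedgesAt x = map (x ,_) (pairs (incidentEdges x))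

  wedges : List Wedge
  wedges = concatMap wedgesAt (V L)

  wedgeEnds : Wedge → List Incidence
  wedgeEnds (x , e₁ , e₂) = (x , e₁) ∷ (x , e₂) ∷ []

  wedgeEnds-wedgesAt : ∀ {x} → x ∈ V L → concatMap wedgeEnds (wedgesAt x) ≡ incidencesAt x
  wedgeEnds-wedgesAt {x} x∈ = begin
    concatMap wedgeEnds (map (x ,_) ps)  ≡⟨ concatMap-map wedgeEnds (x ,_) ps ⟩
    concatMap (map (x ,_) ∘ unpair) ps   ≡⟨ map-concatMap (x ,_) unpair ps ⟨
    map (x ,_) (concatMap unpair ps)     ≡⟨ cong (map (x ,_)) (concatMap-unpair-pairs (incidentEdges x) even) ⟩
    incidencesAt x                       ∎
    where
    open ≡-Reasoning
    ps = pairs (incidentEdges x)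
    even : 2 ∣ length (incidentEdges x)
    even = subst (2 ∣_) (sym (length-map (upair x) (N L x))) (All.lookup even-degrees x∈)

  wedgeEnds-↭ : concatMap wedgeEnds wedges ↭ incidences
  wedgeEnds-↭ = begin
    concatMap wedgeEnds (concatMap wedgesAt (V L))    ≡⟨ concatMap-concatMap wedgeEnds wedgesAt (V L) ⟩
    concatMap (concatMap wedgeEnds ∘ wedgesAt) (V L)  ≡⟨ cong concat (map-cong-local (All.tabulate wedgeEnds-wedgesAt)) ⟩
    concatMap incidencesAt (V L)                      ↭⟨ incidencesAt-↭ ⟩
    incidences                                        ∎
    where open PermutationReasoning

  WedgeOK : Wedge → Set
  WedgeOK (x , e₁ , e₂) = x ∈ V L × e₁ ∈ E L × e₂ ∈ E L

  wedges-ok : All WedgeOK wedges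
  wedges-ok = All.tabulate λ w∈ → let x∈ , e₁∈ = incidence-ok (end w∈ (here refl))
                                      _  , e₂∈ = incidence-ok (end w∈ (there (here refl)))
                                  in  x∈ , e₁∈ , e₂∈
    where
    end : ∀ {w i} → w ∈ wedges → i ∈ wedgeEnds w → i ∈ incidences
    end w∈ i∈ = ∈-resp-↭ wedgeEnds-↭ (∈-concatMap⁺ wedgeEnds (lose w∈ i∈))

  edgeStep : ℕ × ℕ → Step
  edgeStep (x , y) = edgeVertex (x , y) , x ∷ y ∷ φ x ∷ φ y ∷ []

  wedgeSteps : ℕ × Wedge → List Step
  wedgeSteps (i , x , e₁ , e₂) =
    (gadget₀ i , edgeVertex e₁ ∷ φ x ∷ x ∷ []) ∷
    (gadget₁ i , gadget₀ i ∷ edgeVertex e₂ ∷ φ x ∷ x ∷ []) ∷ []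

  indexedWedges : List (ℕ × Wedge)
  indexedWedges = indexedFrom 0 wedges

  edgeSteps wedgeStepList steps : List Step
  edgeSteps     = map edgeStep (E L)
  wedgeStepList = concatMap wedgeSteps indexedWedges
  steps         = edgeSteps ++ wedgeStepList

  edgeStep-attaches : ∀ {x y} → (x , y) ∈ E L → Attaches 4 roots (edgeStep (x , y))
  edgeStep-attaches {x} {y} xy∈ = attaches back∈ back! ≤-refl (All.map (root<edgeVertex (x , y)) back∈)
    where
    x∈ = proj₁ (L-V xy∈)
    y∈ = proj₂ (L-V xy∈)
    back∈ : All (_∈ roots) (x ∷ y ∷ φ x ∷ φ y ∷ [])
    back∈ = inL x∈ ∷ inL y∈ ∷ inL' (φ-V x∈) ∷ inL' (φ-V y∈) ∷ []
    back! : Unique (x ∷ y ∷ φ x ∷ φ y ∷ [])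
    back! = Unique.++⁺ (Unique-pair (<⇒≢ (L-< xy∈))) (Unique-pair (Adj⇒≢ L' (φ-Adj xy∈))) λ where
      (here refl , φ∈)         → L∩L'=∅ x x∈ (All.lookup (φ-V x∈ ∷ φ-V y∈ ∷ []) φ∈)
      (there (here refl) , φ∈) → L∩L'=∅ y y∈ (All.lookup (φ-V x∈ ∷ φ-V y∈ ∷ []) φ∈)

  edgeSteps-valid : ValidSteps 4 roots edgeSteps
  edgeSteps-valid = ValidSteps-parallel edgeSteps
    (subst Unique (map-∘ (E L)) (Unique-map⁺-on edgeVertex-injective (E-uniq L)))
    (All.map⁺ (All.map⁺ (All.tabulate λ {e} _ → All-<⇒∉ (All.tabulate (root<edgeVertex e)))))
    (All.map⁺ (All.tabulate edgeStep-attaches))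

  wedgeSteps-valid : ∀ n P ws → All WedgeOK ws → roots ⊆ P → (∀ {e} → e ∈ E L → edgeVertex e ∈ P) →
                     All (_< gadget₀ n) P → ValidSteps 4 P (concatMap wedgeSteps (indexedFrom n ws))
  wedgeSteps-valid n P []                    _                        _        _        _   = tt
  wedgeSteps-valid n P ((x , e₁ , e₂) ∷ ws) ((x∈ , e₁∈ , e₂∈) ∷ oks) roots⊆P edges⊆P P<g₀ =
    All-<⇒∉ P<g₀ ,
    attaches (back∈ e₁∈) (back! e₁∈) (s≤s (s≤s (s≤s z≤n))) (back<g₀ e₁∈) ,
    All-<⇒∉ (n<1+n _ ∷ All.map m<n⇒m<1+n P<g₀) ,
    attaches (here refl ∷ All.map there (back∈ e₂∈)) (Unique-∷-above (back<g₀ e₂∈) (back! e₂∈)) ≤-refl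
             (n<1+n _ ∷ All.map m<n⇒m<1+n (back<g₀ e₂∈)) ,
    wedgeSteps-valid (suc n) (gadget₁ n ∷ gadget₀ n ∷ P) ws oks (there ∘ there ∘ roots⊆P) (there ∘ there ∘ edges⊆P)
      (n<1+n _ ∷ m<n⇒m<1+n (n<1+n _) ∷ All.map (m<n⇒m<1+n ∘ m<n⇒m<1+n) P<g₀)
    where
    back∈ : ∀ {e} → e ∈ E L → All (_∈ P) (edgeVertex e ∷ φ x ∷ x ∷ [])
    back∈ e∈ = edges⊆P e∈ ∷ roots⊆P (inL' (φ-V x∈)) ∷ roots⊆P (inL x∈) ∷ []
    back! : ∀ {e} → e ∈ E L → Unique (edgeVertex e ∷ φ x ∷ x ∷ [])
    back! {e} e∈ = Unique-∷-above (root<edgeVertex e (inL' (φ-V x∈)) ∷ root<edgeVertex e (inL x∈) ∷ [])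
                                  (Unique-pair (φ≢ x∈))
    back<g₀ : ∀ {e} → e ∈ E L → All (_< gadget₀ n) (edgeVertex e ∷ φ x ∷ x ∷ [])
    back<g₀ e∈ = edgeVertex<gadget₀ n e∈ ∷ root<gadget₀ n (inL' (φ-V x∈)) ∷ root<gadget₀ n (inL x∈) ∷ []

  steps-valid : ValidSteps 4 roots steps
  steps-valid = ValidSteps-++ roots edgeSteps wedgeStepList edgeSteps-valid
    (wedgeSteps-valid 0 (placed roots edgeSteps) wedges wedges-ok (∈-placed⁺ˡ roots edgeSteps)
      (λ e∈ → ∈-placed⁺ʳ roots edgeSteps (∈-map⁺ proj₁ (∈-map⁺ edgeStep e∈)))
      (All.tabulate λ w∈ → [ root<gadget₀ 0 , edgeStepVertex<K₂ ]′ (∈-placed⁻ roots edgeSteps w∈)))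
    where
    edgeStepVertex<K₂ : ∀ {w} → w ∈ newVertices edgeSteps → w < K₂
    edgeStepVertex<K₂ w∈ with ∈-map⁻ proj₁ w∈
    ... | _ , s∈ , refl with ∈-map⁻ edgeStep s∈
    ...   | _ , e∈ , refl = edgeVertex<K₂ e∈

  open StepGraph roots roots! steps steps-valid public

  spoke φ-spoke : Incidence → ℕ × ℕ
  spoke   (v , e) = v , edgeVertex e
  φ-spoke (v , e) = φ v , edgeVertex e

  gadgetEdges : ℕ × Wedge → List (ℕ × ℕ)
  gadgetEdges = concatMap stepEdges ∘ wedgeSteps

  S S' W : List (ℕ × ℕ)
  S  = concatMap (map spoke ∘ ends) (E L)
  S' = concatMap (map φ-spoke ∘ ends) (E L)
  W  = concatMap gadgetEdges indexedWedges

  edges-↭ : E graph ↭ (S ++ S') ++ W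
  edges-↭ = begin
    concatMap stepEdges (edgeSteps ++ wedgeStepList)
      ≡⟨ concatMap-++ stepEdges edgeSteps wedgeStepList ⟩
    concatMap stepEdges edgeSteps ++ concatMap stepEdges wedgeStepList
      ≡⟨ cong₂ _++_ (concatMap-map stepEdges edgeStep (E L)) (concatMap-concatMap stepEdges wedgeSteps indexedWedges) ⟩
    concatMap (λ e → map spoke (ends e) ++ map φ-spoke (ends e)) (E L) ++ W
      ↭⟨ ++⁺ʳ W (concatMap-++-↭ (map spoke ∘ ends) (map φ-spoke ∘ ends) (E L)) ⟩
    (S ++ S') ++ W ∎
    where open PermutationReasoning

  wedge-spokes-↭ : ∀ (f : Incidence → ℕ × ℕ) →
                   concatMap (map f ∘ wedgeEnds ∘ proj₂) indexedWedges ↭ concatMap (map f ∘ ends) (E L)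
  wedge-spokes-↭ f = begin
    concatMap (map f ∘ wedgeEnds ∘ proj₂) indexedWedges  ≡⟨ map-concatMap f (wedgeEnds ∘ proj₂) indexedWedges ⟨
    map f (concatMap (wedgeEnds ∘ proj₂) indexedWedges)  ≡⟨ cong (map f) (concatMap-map wedgeEnds proj₂ indexedWedges) ⟨
    map f (concatMap wedgeEnds (map proj₂ indexedWedges)) ≡⟨ cong (map f ∘ concatMap wedgeEnds)
                                                                  (map-proj₂-indexedFrom 0 wedges) ⟩
    map f (concatMap wedgeEnds wedges)                   ↭⟨ ↭-map⁺ f wedgeEnds-↭ ⟩
    map f incidences                                     ≡⟨ map-concatMap f ends (E L) ⟩
    concatMap (map f ∘ ends) (E L)                       ∎
    where open PermutationReasoning

  triangles-↭ : ∀ (edgeTriangle : ℕ × ℕ → ℕ × ℕ × ℕ) (wedgeTriangles : ℕ × Wedge → List (ℕ × ℕ × ℕ))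
                  (image : ℕ × ℕ → ℕ × ℕ) (f g : Incidence → ℕ × ℕ) →
                (∀ e → triEdges (edgeTriangle e) ↭ image e ∷ map f (ends e)) →
                (∀ q → concatMap triEdges (wedgeTriangles q) ↭ map g (wedgeEnds (proj₂ q)) ++ gadgetEdges q) →
                concatMap triEdges (map edgeTriangle (E L) ++ concatMap wedgeTriangles indexedWedges) ↭
                (map image (E L) ++ concatMap (map f ∘ ends) (E L)) ++ (concatMap (map g ∘ ends) (E L) ++ W)
  triangles-↭ edgeTriangle wedgeTriangles image f g edge-↭ wedge-↭ = begin
    concatMap triEdges (map edgeTriangle (E L) ++ concatMap wedgeTriangles indexedWedges)
      ≡⟨ concatMap-++ triEdges (map edgeTriangle (E L)) (concatMap wedgeTriangles indexedWedges) ⟩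
    concatMap triEdges (map edgeTriangle (E L)) ++ concatMap triEdges (concatMap wedgeTriangles indexedWedges)
      ≡⟨ cong₂ _++_ (concatMap-map triEdges edgeTriangle (E L))
                    (concatMap-concatMap triEdges wedgeTriangles indexedWedges) ⟩
    concatMap (triEdges ∘ edgeTriangle) (E L) ++ concatMap (concatMap triEdges ∘ wedgeTriangles) indexedWedges
      ↭⟨ ++⁺ (concatMap⁺-↭ (E L) edge-↭) (concatMap⁺-↭ indexedWedges wedge-↭) ⟩
    concatMap (λ e → [ image e ] ++ map f (ends e)) (E L) ++
    concatMap (λ q → map g (wedgeEnds (proj₂ q)) ++ gadgetEdges q) indexedWedges
      ↭⟨ ++⁺ (concatMap-++-↭ ([_] ∘ image) (map f ∘ ends) (E L))
             (concatMap-++-↭ (map g ∘ wedgeEnds ∘ proj₂) gadgetEdges indexedWedges) ⟩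
    (concatMap ([_] ∘ image) (E L) ++ concatMap (map f ∘ ends) (E L)) ++
    (concatMap (map g ∘ wedgeEnds ∘ proj₂) indexedWedges ++ W)
      ≡⟨ cong (λ xs → (xs ++ _) ++ _) (trans (sym (concatMap-map [_] image (E L))) (concatMap-pure (map image (E L)))) ⟩
    (map image (E L) ++ concatMap (map f ∘ ends) (E L)) ++
    (concatMap (map g ∘ wedgeEnds ∘ proj₂) indexedWedges ++ W)
      ↭⟨ ++⁺ˡ (map image (E L) ++ _) (++⁺ʳ W (wedge-spokes-↭ g)) ⟩
    (map image (E L) ++ concatMap (map f ∘ ends) (E L)) ++ (concatMap (map g ∘ ends) (E L) ++ W) ∎
    where open PermutationReasoning

  φ-image : ℕ × ℕ → ℕ × ℕ
  φ-image (x , y) = upair (φ x) (φ y)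

  φ-image-↭ : map φ-image (E L) ↭ E L'
  φ-image-↭ = ↭-sym (Unique-⊆-length≤⇒↭ (E-uniq L') (∈-deduplicate⁻ _ _ ∘ ∈-resp-↭ (↭-sym dedup↭)) length≤)
    where
    image⊆ : map φ-image (E L) ⊆ E L'
    image⊆ e∈ with ∈-map⁻ φ-image e∈
    ... | _ , xy∈ , refl = Adj⇒upair∈E L' (φ-Adj xy∈)
    dedup↭ : deduplicate (≡-dec _≟_ _≟_) (map φ-image (E L)) ↭ E L'
    dedup↭ = Unique-⊆-length≤⇒↭ (deduplicate-! _) (image⊆ ∘ ∈-deduplicate⁻ _ (map φ-image (E L)))
               (≤-reflexive (proj₂ (proj₂ (proj₂ hom))))
    length≤ : length (map φ-image (E L)) ≤ length (E L')
    length≤ = ≤-reflexive (trans (length-map φ-image (E L)) (proj₁ (proj₂ (proj₂ hom))))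

  triangleL : ℕ × ℕ → ℕ × ℕ × ℕ
  triangleL (x , y) = x , y , edgeVertex (x , y)

  triangleL' : ℕ × ℕ → ℕ × ℕ × ℕ
  triangleL' (x , y) = proj₁ (φ-image (x , y)) , proj₂ (φ-image (x , y)) , edgeVertex (x , y)

  wedgeTrianglesL wedgeTrianglesL' : ℕ × Wedge → List (ℕ × ℕ × ℕ)
  wedgeTrianglesL (i , x , e₁ , e₂) =
    (φ x , edgeVertex e₁ , gadget₀ i) ∷ (φ x , edgeVertex e₂ , gadget₁ i) ∷ (x , gadget₀ i , gadget₁ i) ∷ []
  wedgeTrianglesL' (i , x , e₁ , e₂) =
    (x , edgeVertex e₁ , gadget₀ i) ∷ (x , edgeVertex e₂ , gadget₁ i) ∷ (φ x , gadget₀ i , gadget₁ i) ∷ []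

  wedgeTrianglesL-↭ : ∀ q → concatMap triEdges (wedgeTrianglesL q) ↭ map φ-spoke (wedgeEnds (proj₂ q)) ++ gadgetEdges q
  wedgeTrianglesL-↭ (i , x , e₁ , e₂) =
    solve 9 (λ a b c d e f g h k →
               a ⊕ (b ⊕ (c ⊕ (d ⊕ (e ⊕ (f ⊕ (g ⊕ (h ⊕ k)))))))
             ⊜ a ⊕ (d ⊕ (c ⊕ (b ⊕ (g ⊕ (k ⊕ (f ⊕ (e ⊕ h))))))))
          ↭-refl
          [ (φ x , z₁) ] [ (φ x , g₀) ] [ (z₁ , g₀) ] [ (φ x , z₂) ] [ (φ x , g₁) ] [ (z₂ , g₁) ]
          [ (x , g₀) ] [ (x , g₁) ] [ (g₀ , g₁) ]
    where
    open ++-Solver (ℕ × ℕ) using (solve; _⊜_; _⊕_)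
    z₁ = edgeVertex e₁
    z₂ = edgeVertex e₂
    g₀ = gadget₀ i
    g₁ = gadget₁ i

  wedgeTrianglesL'-↭ : ∀ q → concatMap triEdges (wedgeTrianglesL' q) ↭ map spoke (wedgeEnds (proj₂ q)) ++ gadgetEdges q
  wedgeTrianglesL'-↭ (i , x , e₁ , e₂) =
    solve 9 (λ a b c d e f g h k →
               a ⊕ (b ⊕ (c ⊕ (d ⊕ (e ⊕ (f ⊕ (g ⊕ (h ⊕ k)))))))
             ⊜ a ⊕ (d ⊕ (c ⊕ (g ⊕ (b ⊕ (k ⊕ (f ⊕ (h ⊕ e))))))))
          ↭-refl
          [ (x , z₁) ] [ (x , g₀) ] [ (z₁ , g₀) ] [ (x , z₂) ] [ (x , g₁) ] [ (z₂ , g₁) ]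
          [ (φ x , g₀) ] [ (φ x , g₁) ] [ (g₀ , g₁) ]
    where
    open ++-Solver (ℕ × ℕ) using (solve; _⊜_; _⊕_)
    z₁ = edgeVertex e₁
    z₂ = edgeVertex e₂
    g₀ = gadget₀ i
    g₁ = gadget₁ i

  gadget-increasing : ∀ {u v e₁ e₂} i → u ∈ roots → v ∈ roots → e₁ ∈ E L → e₂ ∈ E L →
                      All Increasing ((v , edgeVertex e₁ , gadget₀ i) ∷ (v , edgeVertex e₂ , gadget₁ i) ∷
                                      (u , gadget₀ i , gadget₁ i) ∷ [])
  gadget-increasing {e₁ = e₁} {e₂} i u∈ v∈ e₁∈ e₂∈ =
    (root<edgeVertex e₁ v∈ , edgeVertex<gadget₀ i e₁∈) ∷
    (root<edgeVertex e₂ v∈ , m<n⇒m<1+n (edgeVertex<gadget₀ i e₂∈)) ∷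
    (root<gadget₀ i u∈ , n<1+n _) ∷ []

  wedgeTrianglesL-increasing : All Increasing (concatMap wedgeTrianglesL indexedWedges)
  wedgeTrianglesL-increasing = All-concatMap⁺ {f = wedgeTrianglesL} {xs = indexedWedges} λ { {i , x , e₁ , e₂} q∈ →
    let x∈ , e₁∈ , e₂∈ = All.lookup wedges-ok (∈-indexedFrom⁻ wedges q∈)
    in  gadget-increasing i (inL x∈) (inL' (φ-V x∈)) e₁∈ e₂∈ }

  wedgeTrianglesL'-increasing : All Increasing (concatMap wedgeTrianglesL' indexedWedges)
  wedgeTrianglesL'-increasing = All-concatMap⁺ {f = wedgeTrianglesL'} {xs = indexedWedges} λ { {i , x , e₁ , e₂} q∈ →
    let x∈ , e₁∈ , e₂∈ = All.lookup wedges-ok (∈-indexedFrom⁻ wedges q∈)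
    in  gadget-increasing i (inL' (φ-V x∈)) (inL x∈) e₁∈ e₂∈ }

  decomposition-L : K3Decomp (E∪ graph L)
  decomposition-L =
    map triangleL (E L) ++ concatMap wedgeTrianglesL indexedWedges ,
    All.++⁺ (All.map⁺ (All.tabulate λ {e} xy∈ → L-< xy∈ , root<edgeVertex e (inL (proj₂ (L-V xy∈)))))
            wedgeTrianglesL-increasing ,
    (begin
      concatMap triEdges (map triangleL (E L) ++ concatMap wedgeTrianglesL indexedWedges)
        ↭⟨ triangles-↭ triangleL wedgeTrianglesL id spoke φ-spoke (λ _ → ↭-refl) wedgeTrianglesL-↭ ⟩
      (map id (E L) ++ S) ++ (S' ++ W)
        ≡⟨ cong (λ xs → (xs ++ S) ++ (S' ++ W)) (map-id (E L)) ⟩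
      (E L ++ S) ++ (S' ++ W)
        ↭⟨ solve 4 (λ l s s' w → (l ⊕ s) ⊕ (s' ⊕ w) ⊜ ((s ⊕ s') ⊕ w) ⊕ l) ↭-refl (E L) S S' W ⟩
      ((S ++ S') ++ W) ++ E L
        ↭⟨ ++⁺ʳ (E L) edges-↭ ⟨
      E graph ++ E L ∎)
    where
    open PermutationReasoning
    open ++-Solver (ℕ × ℕ) using (solve; _⊜_; _⊕_)

  decomposition-L' : K3Decomp (E∪ graph L')
  decomposition-L' =
    map triangleL' (E L) ++ concatMap wedgeTrianglesL' indexedWedges ,
    All.++⁺ (All.map⁺ (All.tabulate λ {e} xy∈ →
               upair-increasing (Adj⇒≢ L' (φ-Adj xy∈)) ,
               upair-below (root<edgeVertex e (inL' (φ-V (proj₁ (L-V xy∈)))))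
                           (root<edgeVertex e (inL' (φ-V (proj₂ (L-V xy∈)))))))
            wedgeTrianglesL'-increasing ,
    (begin
      concatMap triEdges (map triangleL' (E L) ++ concatMap wedgeTrianglesL' indexedWedges)
        ↭⟨ triangles-↭ triangleL' wedgeTrianglesL' φ-image φ-spoke spoke
             (λ (x , y) → prep _ (upair-spokes-↭ (φ x) (φ y) (edgeVertex (x , y)))) wedgeTrianglesL'-↭ ⟩
      (map φ-image (E L) ++ S') ++ (S ++ W)
        ↭⟨ ++⁺ʳ (S ++ W) (++⁺ʳ S' φ-image-↭) ⟩
      (E L' ++ S') ++ (S ++ W)
        ↭⟨ solve 4 (λ l s s' w → (l ⊕ s') ⊕ (s ⊕ w) ⊜ ((s ⊕ s') ⊕ w) ⊕ l) ↭-refl (E L') S S' W ⟩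
      ((S ++ S') ++ W) ++ E L'
        ↭⟨ ++⁺ʳ (E L') edges-↭ ⟨
      E graph ++ E L' ∎)
    where
    open PermutationReasoning
    open ++-Solver (ℕ × ℕ) using (solve; _⊜_; _⊕_)

  isTransformer : IsTransformer L L' graph
  isTransformer = roots-in , roots-independent , decomposition-L , decomposition-L'

lemma3p4 : (L L' : Graph) → VertexDisjoint L L' → L ⇝ L' →
    All (λ v → 2 ∣ deg L v) (V L) →
    ∃ λ (T : Graph) → IsTransformer L L' T × RootedDegeneracy≤ T (V L ++ V L') 4
lemma3p4 L L' L∩L'=∅ (φ , hom) even-degrees = graph , isTransformer , degeneracy
  where open Transformer L L' L∩L'=∅ φ hom even-degrees
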